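{- Let $k \geq 2$ and $d \geq 0$ be integers. Let $u$ be a word over $\mathbb{Z}_{\geq 0}$ of length $k - 1$. Let $v$ be a nonempty finite word over $\mathbb{Z}_{\geq 0} \cup \{0'\}$ whose first letter is $0'$ and whose remaining letters are in $\mathbb{Z}_{\geq 0}$. Let $\varphi$ be the morphism on $\mathbb{Z}_{\geq 0} \cup \{0'\}$ given by $\varphi(0') = v\,\varphi(0)$ and $\varphi(n) = u\,(n + d)$ for $n \in \mathbb{Z}_{\geq 0}$. Then the sequence of letters of $\tau(\varphi^\infty(0'))$ is a $k$-regular sequence.
   Context: A morphism $\varphi$ on an alphabet $\Sigma$ is a map $\Sigma \to \Sigma^*$, extended to words by concatenation. If $\varphi(c)$ begins with the letter $c$, $\varphi^\infty(c)$ denotes the infinite fixed point of $\varphi$ beginning with $c$. Here $0'$ is a new letter not in $\mathbb{Z}_{\geq 0}$, and $\tau$ is the coding with $\tau(0') = 0$ and $\tau(n) = n$ for $n \in \mathbb{Z}_{\geq 0}$. Letters of an infinite word are indexed from position $0$. For an integer $k \geq 2$, an integer sequence $s(i)_{i \geq 0}$ is $k$-regular if the $\mathbb{Z}$-module generated by the set $\{ s(k^e i + j)_{i \geq 0} : e \geq 0,\ 0 \leq j \leq k^e - 1 \}$ is finitely generated. -}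

module Defs where

open import Data.Nat using (ℕ; zero; suc; _+_; _*_; _^_; _<_)
open import Data.Integer as ℤ using (ℤ; +_)
open import Data.List using (List; []; _∷_; _++_; map; concatMap; length)
open import Data.List.Relation.Unary.All using (All)
open import Data.Product using (Σ; _×_; _,_; ∃-syntax)
open import Relation.Binary.PropositionalEquality using (_≡_)

data Letter : Set where
  zero′ : Letter
  num   : ℕ → Letter

Word : Set
Word = List Letter

τ : Letter → ℕ
τ zero′   = 0
τ (num n) = n

φ : (u : List ℕ) (rest : List ℕ) (d : ℕ) → Letter → Word
φ u rest d (num n) = map num u ++ (num (n + d) ∷ [])
φ u rest d zero′   = (zero′ ∷ map num rest) ++ φ u rest d (num 0)

φ* : (Letter → Word) → Word → Word
φ* f = concatMap f

iter : ℕ → (Word → Word) → Word → Word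
iter zero    g w = w
iter (suc n) g w = g (iter n g w)

lookupD : Word → ℕ → Letter
lookupD []       _       = zero′   -- default, never used for fixed points below
lookupD (x ∷ xs) zero    = x
lookupD (x ∷ xs) (suc i) = lookupD xs i

-- The infinite fixed point f^∞(0') of a morphism f with f(0') beginning with 0':
-- its letter at position i is the letter at position i of f^(i+1)(0').
-- (When |f(0')| ≥ 2 and f is non-erasing, |f^(n)(0')| ≥ n+1, so these are the
-- letters of the limit word.)
fixedPoint : (Letter → Word) → ℕ → Letter
fixedPoint f i = lookupD (iter (suc i) (φ* f) (zero′ ∷ [])) i

Seq : Set
Seq = ℕ → ℤ

KIndex : ℕ → Set
KIndex k = Σ ℕ λ e → Σ ℕ λ j → j < k ^ e

kernelElt : ℕ → Seq → ℕ → ℕ → Seq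
kernelElt k s e j i = s (k ^ e * i + j)

kernelComb : (k : ℕ) → Seq → List (ℤ × KIndex k) → Seq
kernelComb k s []                          i = + 0
kernelComb k s ((c , (e , j , _)) ∷ xs) i = c ℤ.* kernelElt k s e j i ℤ.+ kernelComb k s xs i

InKernelModule : ℕ → Seq → Seq → Set
InKernelModule k s t = ∃[ cs ] (∀ i → t i ≡ kernelComb k s cs i)

linComb : List ℤ → List Seq → Seq
linComb (c ∷ cs) (g ∷ gs) i = c ℤ.* g i ℤ.+ linComb cs gs i
linComb _        _        i = + 0

InSpan : List Seq → Seq → Set
InSpan gs t = ∃[ cs ] (length cs ≡ length gs × (∀ i → t i ≡ linComb cs gs i))

-- s is k-regular: the ℤ-module M generated by {s(k^e i + j) : e ≥ 0, 0 ≤ j < k^e}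
-- is finitely generated, i.e. there are finitely many elements gs of M
-- such that every generator of M (hence all of M) lies in the span of gs.
Regular : ℕ → Seq → Set
Regular k s = ∃[ gs ] (All (InKernelModule k s) gs
                      × (∀ e j → j < k ^ e → InSpan gs (kernelElt k s e j)))

module Submission where

-- The fixed point w = φ^∞(0') satisfies w = φ(w) = 0' rest · φ(w₀ w₁ …), so after its
-- first a = |0' rest| letters, τ(w) is cut into blocks of length k = |u| + 1, block m
-- being u followed by τ(wₘ) + d.
--
-- For large l the elements of level l + 2
-- are integer combinations of those of levels l and l + 1:
--   * J inside a block, at an inner letter: s(kˡ⁺² i + J) is a constant letter of u,
--     equal to s(kˡ⁺¹ i + J′) for a suitable J′;
--   * J at the end of block m: s(kˡ⁺² i + J) = s(kˡ⁺¹ i + m) + d, and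
--     d = s(kˡ⁺¹ i + A) − s(kˡ i) for A the end of block 0;
--   * J in the prefix: s(kˡ i + J), s(kˡ⁺¹ i + J), s(kˡ⁺² i + J) form an arithmetic
--     progression, shown by descending through parent blocks (progression-descent).
-- Hence the kernel elements of bounded level generate the whole kernel module.

open import Defs
open import Data.Nat as ℕ
  using (ℕ; zero; suc; _+_; _*_; _^_; _≤_; _<_; _∸_; z≤n; s≤s; _<?_; NonZero; >-nonZero⁻¹)
open import Data.Nat.DivMod using (_/_; _%_; m≡m%n+[m/n]*n; m%n<n)
open import Data.Nat.Properties
open import Data.Integer as ℤ using (ℤ; +_)
import Data.Integer.Properties as ℤ
open import Data.List using (List; []; _∷_; _++_; map; zipWith; replicate; length; concatMap; upTo)
open import Data.List.Properties
  using (length-map; length-replicate; length-++; ++-assoc; ++-identityʳ; map-++; concatMap-map; concatMap-cong; concatMap-++; map-concatMap)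
open import Function using (_∘_)
import Data.List.Relation.Unary.All as All
open import Data.List.Relation.Unary.Any as Any using (here; there)
open import Data.List.Membership.Propositional using (_∈_)
open import Data.List.Membership.Propositional.Properties
  using (∈-map⁺; ∈-map⁻; ∈-concatMap⁺; ∈-concatMap⁻; ∈-upTo⁺; ∈-upTo⁻)
open import Data.Product using (_×_; _,_; proj₁; uncurry; ∃-syntax)
open import Data.Sum using (inj₁; inj₂)
open import Data.Empty using (⊥; ⊥-elim)
open import Relation.Nullary using (yes; no; contradiction)
open import Relation.Binary.PropositionalEquality
import Data.Nat.Tactic.RingSolver as ℕ-Solver
import Data.Integer.Tactic.RingSolver as ℤ-Solver

linComb-+ : ∀ xs ys gs → length xs ≡ length ys → ∀ i →
  linComb (zipWith ℤ._+_ xs ys) gs i ≡ linComb xs gs i ℤ.+ linComb ys gs i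
linComb-+ []       []       gs       _ i = refl
linComb-+ (_ ∷ _)  (_ ∷ _)  []       _ i = refl
linComb-+ (x ∷ xs) (y ∷ ys) (g ∷ gs) p i =
  trans (cong (λ r → (x ℤ.+ y) ℤ.* g i ℤ.+ r) (linComb-+ xs ys gs (suc-injective p) i))
        (regroup x y (g i) (linComb xs gs i) (linComb ys gs i))
  where
    regroup : ∀ x y g a b → (x ℤ.+ y) ℤ.* g ℤ.+ (a ℤ.+ b) ≡ (x ℤ.* g ℤ.+ a) ℤ.+ (y ℤ.* g ℤ.+ b)
    regroup = ℤ-Solver.solve-∀

linComb-neg : ∀ xs gs i → linComb (map ℤ.-_ xs) gs i ≡ ℤ.- linComb xs gs i
linComb-neg []       gs       i = refl
linComb-neg (_ ∷ _)  []       i = refl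
linComb-neg (x ∷ xs) (g ∷ gs) i =
  trans (cong (λ r → (ℤ.- x) ℤ.* g i ℤ.+ r) (linComb-neg xs gs i)) (negate x (g i) (linComb xs gs i))
  where
    negate : ∀ x g a → (ℤ.- x) ℤ.* g ℤ.+ ℤ.- a ≡ ℤ.- (x ℤ.* g ℤ.+ a)
    negate = ℤ-Solver.solve-∀

linComb-zero : ∀ n gs i → linComb (replicate n (+ 0)) gs i ≡ + 0
linComb-zero zero    gs       i = refl
linComb-zero (suc n) []       i = refl
linComb-zero (suc n) (g ∷ gs) i = trans (cong (λ r → + 0 ℤ.* g i ℤ.+ r) (linComb-zero n gs i)) (ℤ.+-identityʳ _)

span-ext : ∀ {gs f g} → (∀ i → g i ≡ f i) → InSpan gs f → InSpan gs g
span-ext g≗f (cs , len , f≡) = cs , len , λ i → trans (g≗f i) (f≡ i)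

span-+ : ∀ {gs f g} → InSpan gs f → InSpan gs g → InSpan gs (λ i → f i ℤ.+ g i)
span-+ {gs} (xs , lx , f≡) (ys , ly , g≡) =
  zipWith ℤ._+_ xs ys ,
  length-zipWith-+ xs ys lx ly ,
  λ i → trans (cong₂ ℤ._+_ (f≡ i) (g≡ i)) (sym (linComb-+ xs ys gs (trans lx (sym ly)) i))
  where
    length-zipWith-+ : ∀ {n} (xs ys : List ℤ) → length xs ≡ n → length ys ≡ n →
      length (zipWith ℤ._+_ xs ys) ≡ n
    length-zipWith-+ []       []       p _ = p
    length-zipWith-+ []       (_ ∷ _)  p q = p
    length-zipWith-+ (_ ∷ _)  []       p q = q
    length-zipWith-+ {suc n} (_ ∷ xs) (_ ∷ ys) p q =
      cong suc (length-zipWith-+ xs ys (suc-injective p) (suc-injective q))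

span-neg : ∀ {gs f} → InSpan gs f → InSpan gs (λ i → ℤ.- f i)
span-neg {gs} (xs , lx , f≡) =
  map ℤ.-_ xs , trans (length-map ℤ.-_ xs) lx ,
  λ i → trans (cong ℤ.-_ (f≡ i)) (sym (linComb-neg xs gs i))

span-member : ∀ {gs g} → g ∈ gs → InSpan gs g
span-member {g ∷ gs} (here refl) =
  + 1 ∷ replicate (length gs) (+ 0) , cong suc (length-replicate (length gs)) ,
  λ i → sym (trans (cong (λ r → + 1 ℤ.* g i ℤ.+ r) (linComb-zero (length gs) gs i)) (unit (g i)))
  where
    unit : ∀ x → + 1 ℤ.* x ℤ.+ + 0 ≡ x
    unit = ℤ-Solver.solve-∀
span-member {h ∷ gs} (there g∈gs) with span-member g∈gs
... | cs , len , g≡ = + 0 ∷ cs , cong suc len , λ i → trans (g≡ i) (sym (ℤ.+-identityˡ _))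

-- A natural-number identity p + q ≡ r + t exhibits p as the integer combination r + (t − q).
span-identity : ∀ {gs} (p q r t : ℕ → ℕ) →
  InSpan gs (λ i → + r i) → InSpan gs (λ i → + t i) → InSpan gs (λ i → + q i) →
  (∀ i → p i + q i ≡ r i + t i) → InSpan gs (λ i → + p i)
span-identity p q r t r∈ t∈ q∈ p+q≡r+t =
  span-ext p≡ (span-+ r∈ (span-+ t∈ (span-neg q∈)))
  where
    p≡ : ∀ i → + p i ≡ + r i ℤ.+ (+ t i ℤ.+ ℤ.- + q i)
    p≡ i = begin
      + p i                                  ≡⟨ cancel (+ p i) (+ q i) ⟩
      (+ p i ℤ.+ + q i) ℤ.+ ℤ.- + q i        ≡⟨ cong (ℤ._+ ℤ.- + q i) (sym (ℤ.pos-+ (p i) (q i))) ⟩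
      + (p i + q i) ℤ.+ ℤ.- + q i            ≡⟨ cong (λ n → + n ℤ.+ ℤ.- + q i) (p+q≡r+t i) ⟩
      + (r i + t i) ℤ.+ ℤ.- + q i            ≡⟨ cong (ℤ._+ ℤ.- + q i) (ℤ.pos-+ (r i) (t i)) ⟩
      (+ r i ℤ.+ + t i) ℤ.+ ℤ.- + q i        ≡⟨ ℤ.+-assoc (+ r i) (+ t i) (ℤ.- + q i) ⟩
      + r i ℤ.+ (+ t i ℤ.+ ℤ.- + q i)        ∎
      where
        open ≡-Reasoning
        cancel : ∀ x y → x ≡ (x ℤ.+ y) ℤ.+ ℤ.- y
        cancel = ℤ-Solver.solve-∀

kernelIndices : ℕ → ℕ → List (ℕ × ℕ)
kernelIndices k E = concatMap (λ e → map (e ,_) (upTo (k ^ e))) (upTo (suc E))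

∈-kernelIndices⁺ : ∀ {k E e J} → e ≤ E → J < k ^ e → (e , J) ∈ kernelIndices k E
∈-kernelIndices⁺ {k} e≤E J<kᵉ =
  ∈-concatMap⁺ (λ e → map (e ,_) (upTo (k ^ e)))
    (Any.map (λ { refl → ∈-map⁺ (_ ,_) (∈-upTo⁺ J<kᵉ) }) (∈-upTo⁺ (s≤s e≤E)))

∈-kernelIndices⁻ : ∀ {k E e J} → (e , J) ∈ kernelIndices k E → J < k ^ e
∈-kernelIndices⁻ {k} {E} eJ∈
  with Any.satisfied (∈-concatMap⁻ (λ e → map (e ,_) (upTo (k ^ e))) {xs = upTo (suc E)} eJ∈)
... | e′ , eJ∈′ with ∈-map⁻ (e′ ,_) eJ∈′
... | J′ , J′∈ , refl = ∈-upTo⁻ J′∈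

kernelUpTo : ℕ → Seq → ℕ → List Seq
kernelUpTo k s E = map (uncurry (kernelElt k s)) (kernelIndices k E)

Level : ℕ → Seq → List Seq → ℕ → Set
Level k s gs e = ∀ J → J < k ^ e → InSpan gs (kernelElt k s e J)

two-step-induction : (P : ℕ → Set) (L : ℕ) → (∀ e → e ≤ suc L → P e) →
  (∀ l → L ≤ l → P l → P (suc l) → P (suc (suc l))) → ∀ e → P e
two-step-induction P L initial step e = proj₁ (consecutive e)
  where
    consecutive : ∀ e → P e × P (suc e)
    consecutive zero = initial 0 z≤n , initial 1 (s≤s z≤n)
    consecutive (suc e) with consecutive e | suc (suc e) ℕ.≤? suc L
    ... | _  , P₁ | yes e+2≤L+1 = P₁ , initial (suc (suc e)) e+2≤L+1
    ... | P₀ , P₁ | no  e+2≰L+1 = P₁ , step e (≤-pred (≤-pred (≰⇒> e+2≰L+1))) P₀ P₁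

-- Regularity criterion: if from level L on every kernel level lies in the span of
-- the two preceding ones, then the kernel elements of level ≤ L + 1 generate the
-- whole kernel module, so s is k-regular.
regular-by-recurrence : ∀ k s L →
  (∀ gs l → L ≤ l → Level k s gs l → Level k s gs (suc l) → Level k s gs (suc (suc l))) →
  Regular k s
regular-by-recurrence k s L step =
  gs , All.tabulate in-kernel-module , two-step-induction (Level k s gs) L initial (step gs)
  where
    gs : List Seq
    gs = kernelUpTo k s (suc L)

    initial : ∀ e → e ≤ suc L → Level k s gs e
    initial e e≤L+1 J J<kᵉ = span-member (∈-map⁺ (uncurry (kernelElt k s)) (∈-kernelIndices⁺ {k} {suc L} e≤L+1 J<kᵉ))

    in-kernel-module : ∀ {g} → g ∈ gs → InKernelModule k s g
    in-kernel-module g∈gs with ∈-map⁻ (uncurry (kernelElt k s)) {xs = kernelIndices k (suc L)} g∈gs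
    ... | (e , J) , eJ∈ , refl =
      (+ 1 , e , J , ∈-kernelIndices⁻ {k} {suc L} eJ∈) ∷ [] , λ i → sym (unit (kernelElt k s e J i))
      where
        unit : ∀ x → + 1 ℤ.* x ℤ.+ + 0 ≡ x
        unit = ℤ-Solver.solve-∀

n<mⁿ : ∀ m → 1 < m → ∀ n → n < m ^ n
n<mⁿ m 1<m zero    = s≤s z≤n
n<mⁿ m 1<m (suc n) = ≤-<-trans (n<mⁿ m 1<m n) (^-monoʳ-< m 1<m (n<1+n n))

factor-out : ∀ n .{{_ : NonZero n}} X Y W → n * X ≡ W + n * Y →
  ∃[ W′ ] (W ≡ n * W′ × X ≡ W′ + Y)
factor-out n X Y W eq = X ∸ Y , W≡ , sym (m∸n+n≡m Y≤X)
  where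
    open ≡-Reasoning
    Y≤X : Y ≤ X
    Y≤X = *-cancelˡ-≤ n (≤-trans (m≤n+m (n * Y) W) (≤-reflexive (sym eq)))
    W≡ : W ≡ n * (X ∸ Y)
    W≡ = begin
      W                  ≡⟨ sym (m+n∸n≡m W (n * Y)) ⟩
      W + n * Y ∸ n * Y  ≡⟨ cong (_∸ n * Y) (sym eq) ⟩
      n * X ∸ n * Y      ≡⟨ sym (*-distribˡ-∸ n X Y) ⟩
      n * (X ∸ Y)        ∎

module BlockSequence (k₁ a d : ℕ) .{{_ : NonZero k₁}} (U s : ℕ → ℕ)
  (letter-law : ∀ m j → j < k₁ → s (a + suc k₁ * m + j) ≡ U j)
  (final-law  : ∀ m → s (a + suc k₁ * m + k₁) ≡ s m + d) where

  k : ℕ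
  k = suc k₁

  -- k ≥ 2 is what makes kernel levels grow: n < kⁿ.
  1<k : 1 < k
  1<k = s≤s (>-nonZero⁻¹ k₁)

  -- The position of the last letter of block 0.
  A : ℕ
  A = a + k₁

  data Position : ℕ → Set where
    prefix : ∀ {J} → J < a → Position J
    letter : ∀ m j → j < k₁ → Position (a + k * m + j)
    final  : ∀ m → Position (a + k * m + k₁)

  position : ∀ J → Position J
  position J with J <? a
  ... | yes J<a = prefix J<a
  ... | no  J≮a = subst Position J≡ (inBlock q r (m%n<n (J ∸ a) k))
    where
      open ≡-Reasoning
      q r : ℕ
      q = (J ∸ a) / k
      r = (J ∸ a) % k
      J≡ : a + k * q + r ≡ J
      J≡ = begin
        a + k * q + r    ≡⟨ +-assoc a (k * q) r ⟩
        a + (k * q + r)  ≡⟨ cong (λ n → a + (n + r)) (*-comm k q) ⟩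
        a + (q * k + r)  ≡⟨ cong (λ n → a + n) (+-comm (q * k) r) ⟩
        a + (r + q * k)  ≡⟨ cong (λ n → a + n) (sym (m≡m%n+[m/n]*n (J ∸ a) k)) ⟩
        a + (J ∸ a)      ≡⟨ m+[n∸m]≡n (≮⇒≥ J≮a) ⟩
        J                ∎
      inBlock : ∀ m j → j < k → Position (a + k * m + j)
      inBlock m j j<k with m≤n⇒m<n∨m≡n (≤-pred j<k)
      ... | inj₁ j<k₁ = letter m j j<k₁
      ... | inj₂ refl = final m

  Progression : ℕ → ℕ → ℕ → Set
  Progression x y z = s z + s x ≡ s y + s y

  letters-progression : ∀ m₀ m₁ m₂ j → j < k₁ →
    Progression (a + k * m₀ + j) (a + k * m₁ + j) (a + k * m₂ + j)
  letters-progression m₀ m₁ m₂ j j<k₁ = begin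
    s (a + k * m₂ + j) + s (a + k * m₀ + j)  ≡⟨ cong₂ _+_ (letter-law m₂ j j<k₁) (letter-law m₀ j j<k₁) ⟩
    U j + U j                                ≡⟨ sym (cong₂ _+_ (letter-law m₁ j j<k₁) (letter-law m₁ j j<k₁)) ⟩
    s (a + k * m₁ + j) + s (a + k * m₁ + j)  ∎
    where open ≡-Reasoning

  finals-progression : ∀ m₀ m₁ m₂ → Progression m₀ m₁ m₂ →
    Progression (a + k * m₀ + k₁) (a + k * m₁ + k₁) (a + k * m₂ + k₁)
  finals-progression m₀ m₁ m₂ p
    rewrite final-law m₀ | final-law m₁ | final-law m₂ = shift (s m₂) (s m₀) (s m₁) p
    where
      shift : ∀ x y z → x + y ≡ z + z → x + d + (y + d) ≡ z + d + (z + d)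
      shift x y z eq = trans (regroup x y d) (trans (cong (_+ (d + d)) eq) (sym (regroup z z d)))
        where
          regroup : ∀ x y d → x + d + (y + d) ≡ (x + y) + (d + d)
          regroup = ℕ-Solver.solve-∀

  ProgressionFrom : ℕ → ℕ → Set
  ProgressionFrom x Δ = Progression x (x + Δ) (x + Δ + k * Δ)

  from-blocks : ∀ m j Δ →
    Progression (a + k * m + j) (a + k * (m + Δ) + j) (a + k * (m + Δ + k * Δ) + j) →
    ProgressionFrom (a + k * m + j) (k * Δ)
  from-blocks m j Δ = subst₂ (Progression (a + k * m + j)) (sym (step₁ k₁ a m j Δ)) (sym (step₂ k₁ a m j Δ))
    where
      step₁ : ∀ k₁ a m j Δ → a + suc k₁ * m + j + suc k₁ * Δ ≡ a + suc k₁ * (m + Δ) + j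
      step₁ = ℕ-Solver.solve-∀
      step₂ : ∀ k₁ a m j Δ → a + suc k₁ * m + j + suc k₁ * Δ + suc k₁ * (suc k₁ * Δ)
                             ≡ a + suc k₁ * (m + Δ + suc k₁ * Δ) + j
      step₂ = ℕ-Solver.solve-∀

  -- ρ x = k₁ x + A turns "last letter of block m" into multiplication by k.
  ρ : ℕ → ℕ
  ρ x = k₁ * x + A

  ρ-final : ∀ m → ρ (a + k * m + k₁) ≡ k * ρ m
  ρ-final m = identity k₁ a m
    where
      identity : ∀ k₁ a m → k₁ * (a + suc k₁ * m + k₁) + (a + k₁) ≡ suc k₁ * (k₁ * m + (a + k₁))
      identity = ℕ-Solver.solve-∀

  ρ-prefix : ∀ {x} → x < a → ρ x ≤ k₁ * (a + A)
  ρ-prefix {x} x<a = begin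
    k₁ * x + A       ≤⟨ +-monoˡ-≤ A (*-monoʳ-≤ k₁ (<⇒≤ x<a)) ⟩
    k₁ * a + A       ≤⟨ +-monoʳ-≤ (k₁ * a) (m≤n*m A k₁) ⟩
    k₁ * a + k₁ * A  ≡⟨ sym (*-distribˡ-+ k₁ a A) ⟩
    k₁ * (a + A)     ∎
    where open ≤-Reasoning

  beyond-prefix : ∀ {x W N} → ρ x ≡ W + k₁ * N → 1 ≤ W → a + A ≤ N → x < a → ⊥
  beyond-prefix {x} {W} {N} ρx≡ 1≤W a+A≤N x<a = <-irrefl refl (begin-strict
    ρ x           ≤⟨ ρ-prefix x<a ⟩
    k₁ * (a + A)  ≤⟨ *-monoʳ-≤ k₁ a+A≤N ⟩
    k₁ * N        <⟨ m<n+m (k₁ * N) 1≤W ⟩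
    W + k₁ * N    ≡⟨ sym ρx≡ ⟩
    ρ x           ∎)
    where open ≤-Reasoning

  -- If x is an inner letter of its block, so are the other two positions and all three
  -- values equal; if x ends block m, the triple is the image of the triple starting
  -- at m with t − 1 in place of t and W / k in place of W.  Since W < kᵗ, W cannot be
  -- divided by k t times, so the descent ends at inner letters.
  progression-descent : ∀ t M → a + A ≤ M → ∀ x W → ρ x ≡ W + k₁ * (k ^ t * M) →
    1 ≤ W → W < k ^ t → ProgressionFrom x (k₁ * (k ^ t * M))
  progression-descent zero M _ x W _ 1≤W W<1 = ⊥-elim (<-irrefl refl (<-≤-trans W<1 1≤W))
  progression-descent (suc t) M a+A≤M x W ρx≡ 1≤W W<kᵗ⁺¹ =
    subst (ProgressionFrom x) (Δ-step k₁ (k ^ t) M) (by-position x (position x) ρx≡)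
    where
      Δ : ℕ
      Δ = k₁ * (k ^ t * M)

      Δ-step : ∀ k₁ K M → suc k₁ * (k₁ * (K * M)) ≡ k₁ * (suc k₁ * K * M)
      Δ-step = ℕ-Solver.solve-∀

      a+A≤N : a + A ≤ k ^ suc t * M
      a+A≤N = ≤-trans a+A≤M (m≤n*m M (k ^ suc t) {{m^n≢0 k (suc t)}})

      by-position : ∀ x → Position x → ρ x ≡ W + k₁ * (k ^ suc t * M) → ProgressionFrom x (k * Δ)
      by-position x (prefix x<a) ρx≡ = ⊥-elim (beyond-prefix ρx≡ 1≤W a+A≤N x<a)
      by-position _ (letter m j j<k₁) _ = from-blocks m j Δ (letters-progression _ _ _ j j<k₁)
      by-position _ (final m) ρx≡
        with factor-out k (ρ m) Δ W (trans (sym (ρ-final m)) (trans ρx≡ (cong (λ n → W + n) (sym (Δ-step k₁ (k ^ t) M)))))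
      ... | zero , W≡k*0 , _ = ⊥-elim (contradiction (subst (1 ≤_) (trans W≡k*0 (*-zeroʳ k)) 1≤W) λ ())
      ... | suc W′ , W≡kW′ , ρm≡ =
        from-blocks m k₁ Δ (finals-progression _ _ _
          (progression-descent t M a+A≤M m (suc W′) ρm≡ (s≤s z≤n)
            (*-cancelˡ-< k (suc W′) (k ^ t) (subst (_< k ^ suc t) W≡kW′ W<kᵗ⁺¹))))

  -- From level L on, the kernel satisfies a two-step recurrence.
  L : ℕ
  L = (a + A) + suc a

  -- For J < a and l ≥ L, s is in arithmetic progression along the kernel positions
  -- kˡ i + J, kˡ⁺¹ i + J, kˡ⁺² i + J: for i > 0 this is the descent lemma with
  -- t = a + 1 and W = k₁ J + A.
  prefix-progression : ∀ l {J} → L ≤ l → J < a → ∀ i →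
    Progression (k ^ l * i + J) (k ^ suc l * i + J) (k ^ suc (suc l) * i + J)
  prefix-progression l L≤l J<a zero
    rewrite *-zeroʳ (k ^ l) | *-zeroʳ (k ^ suc l) | *-zeroʳ (k ^ suc (suc l)) = refl
  prefix-progression l {J} L≤l J<a i@(suc _) =
    subst₂ (Progression x) (positions₁ k₁ (k ^ l) i J) (positions₂ k₁ (k ^ l) i J)
      (subst (ProgressionFrom x) (cong (k₁ *_) (sym kˡi≡)) descent)
    where
      open ≤-Reasoning
      x r M W : ℕ
      x = k ^ l * i + J
      r = l ∸ suc a
      M = k ^ r * i
      W = k₁ * J + A

      kˡi≡ : k ^ l * i ≡ k ^ suc a * M
      kˡi≡ = begin-equality
        k ^ l * i              ≡⟨ cong (λ e → k ^ e * i) (sym (m+[n∸m]≡n (m+n≤o⇒n≤o (a + A) L≤l))) ⟩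
        k ^ (suc a + r) * i    ≡⟨ cong (_* i) (^-distribˡ-+-* k (suc a) r) ⟩
        k ^ suc a * k ^ r * i  ≡⟨ *-assoc (k ^ suc a) (k ^ r) i ⟩
        k ^ suc a * M          ∎

      ρx≡ : ρ x ≡ W + k₁ * (k ^ suc a * M)
      ρx≡ = trans (ρ-split k₁ a (k ^ l * i) J) (cong (λ n → W + k₁ * n) kˡi≡)
        where
          ρ-split : ∀ k₁ a P J → k₁ * (P + J) + (a + k₁) ≡ (k₁ * J + (a + k₁)) + k₁ * P
          ρ-split = ℕ-Solver.solve-∀

      1≤W : 1 ≤ W
      1≤W = ≤-trans (>-nonZero⁻¹ k₁) (≤-trans (m≤n+m k₁ a) (m≤n+m A (k₁ * J)))

      W<kᵃ⁺¹ : W < k ^ suc a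
      W<kᵃ⁺¹ = ≤-<-trans W≤ka (*-monoʳ-< k (n<mⁿ k 1<k a))
        where
          regroup : ∀ k₁ J a → k₁ * J + (a + k₁) ≡ a + k₁ * suc J
          regroup = ℕ-Solver.solve-∀
          W≤ka : W ≤ k * a
          W≤ka = begin
            k₁ * J + (a + k₁)  ≡⟨ regroup k₁ J a ⟩
            a + k₁ * suc J     ≤⟨ +-monoʳ-≤ a (*-monoʳ-≤ k₁ J<a) ⟩
            a + k₁ * a         ∎

      a+A≤M : a + A ≤ M
      a+A≤M = begin
        a + A    ≤⟨ <⇒≤ (n<mⁿ k 1<k (a + A)) ⟩
        k ^ (a + A)  ≤⟨ ^-monoʳ-≤ k (m+n≤o⇒m≤o∸n (a + A) L≤l) ⟩
        k ^ r    ≤⟨ m≤m*n (k ^ r) i ⟩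
        M        ∎

      descent : ProgressionFrom x (k₁ * (k ^ suc a * M))
      descent = progression-descent (suc a) M a+A≤M x W ρx≡ 1≤W W<kᵃ⁺¹

      positions₁ : ∀ k₁ K i J → K * i + J + k₁ * (K * i) ≡ suc k₁ * K * i + J
      positions₁ = ℕ-Solver.solve-∀
      positions₂ : ∀ k₁ K i J → K * i + J + k₁ * (K * i) + suc k₁ * (k₁ * (K * i))
                                ≡ suc k₁ * (suc k₁ * K) * i + J
      positions₂ = ℕ-Solver.solve-∀

  block-index : ∀ K i m j → k * K * i + (a + k * m + j) ≡ a + k * (K * i + m) + j
  block-index = identity k₁ a
    where
      identity : ∀ k₁ a K i m j → suc k₁ * K * i + (a + suc k₁ * m + j) ≡ a + suc k₁ * (K * i + m) + j
      identity = ℕ-Solver.solve-∀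

  first-block-index : ∀ K i j → k * K * i + (a + j) ≡ a + k * (K * i) + j
  first-block-index = identity k₁ a
    where
      identity : ∀ k₁ a K i j → suc k₁ * K * i + (a + j) ≡ a + suc k₁ * (K * i) + j
      identity = ℕ-Solver.solve-∀

  -- Kernel positions at an inner letter all carry U j.
  letter-kernel : ∀ l m j → j < k₁ → ∀ i →
    s (k ^ suc (suc l) * i + (a + k * m + j)) ≡ s (k ^ suc l * i + (a + j))
  letter-kernel l m j j<k₁ i = begin
    s (k ^ suc (suc l) * i + (a + k * m + j))  ≡⟨ cong s (block-index (k ^ suc l) i m j) ⟩
    s (a + k * (k ^ suc l * i + m) + j)        ≡⟨ letter-law _ j j<k₁ ⟩
    U j                                        ≡⟨ sym (letter-law _ j j<k₁) ⟩
    s (a + k * (k ^ l * i) + j)                ≡⟨ cong s (sym (first-block-index (k ^ l) i j)) ⟩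
    s (k ^ suc l * i + (a + j))                ∎
    where open ≡-Reasoning

  -- Kernel positions at the end of a block: both sides equal s (kˡ⁺¹ i + m) + s (kˡ i) + d.
  final-kernel : ∀ l m i →
    s (k ^ suc (suc l) * i + (a + k * m + k₁)) + s (k ^ l * i + 0)
      ≡ s (k ^ suc l * i + m) + s (k ^ suc l * i + A)
  final-kernel l m i = begin
    s (k ^ suc (suc l) * i + (a + k * m + k₁)) + s (k ^ l * i + 0)
      ≡⟨ cong₂ _+_ (trans (cong s (block-index (k ^ suc l) i m k₁)) (final-law _))
                   (cong s (+-identityʳ (k ^ l * i))) ⟩
    p + d + q    ≡⟨ +-assoc p d q ⟩
    p + (d + q)  ≡⟨ cong (λ n → p + n) (+-comm d q) ⟩
    p + (q + d)  ≡⟨ cong (λ n → p + n) (sym (trans (cong s (first-block-index (k ^ l) i k₁)) (final-law _))) ⟩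
    p + s (k ^ suc l * i + A)  ∎
    where
      open ≡-Reasoning
      p q : ℕ
      p = s (k ^ suc l * i + m)
      q = s (k ^ l * i)

  Sq : Seq
  Sq i = + s i

  below-level : ∀ {n l} → n ≤ l → n < k ^ l
  below-level {n} {l} n≤l = ≤-<-trans n≤l (n<mⁿ k 1<k l)

  level-step : ∀ gs l → L ≤ l → Level k Sq gs l → Level k Sq gs (suc l) →
    Level k Sq gs (suc (suc l))
  level-step gs l L≤l level₀ level₁ J J<kˡ⁺² = by-position J (position J) J<kˡ⁺²
    where
      a≤l : a ≤ l
      a≤l = ≤-trans (n≤1+n a) (m+n≤o⇒n≤o (a + A) L≤l)
      A<kˡ⁺¹ : A < k ^ suc l
      A<kˡ⁺¹ = below-level (≤-trans (m≤n+m A a) (≤-trans (m+n≤o⇒m≤o (a + A) L≤l) (n≤1+n l)))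
      kˡ≤kˡ⁺¹ : k ^ l ≤ k ^ suc l
      kˡ≤kˡ⁺¹ = ^-monoʳ-≤ k (n≤1+n l)

      by-position : ∀ J → Position J → J < k ^ suc (suc l) →
        InSpan gs (kernelElt k Sq (suc (suc l)) J)
      by-position J (prefix J<a) _ =
        span-identity _ _ _ _ (level₁ J J<kˡ⁺¹) (level₁ J J<kˡ⁺¹) (level₀ J J<kˡ)
          (prefix-progression l L≤l J<a)
        where
          J<kˡ : J < k ^ l
          J<kˡ = below-level (≤-trans (<⇒≤ J<a) a≤l)
          J<kˡ⁺¹ : J < k ^ suc l
          J<kˡ⁺¹ = <-≤-trans J<kˡ kˡ≤kˡ⁺¹
      by-position _ (letter m j j<k₁) _ =
        span-ext (λ i → cong +_ (letter-kernel l m j j<k₁ i)) (level₁ (a + j) a+j<kˡ⁺¹)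
        where
          a+j<kˡ⁺¹ : a + j < k ^ suc l
          a+j<kˡ⁺¹ = <-trans (+-monoʳ-< a j<k₁) A<kˡ⁺¹
      by-position _ (final m) J<kˡ⁺² =
        span-identity _ _ _ _ (level₁ m m<kˡ⁺¹) (level₁ A A<kˡ⁺¹) (level₀ 0 (m^n>0 k l))
          (final-kernel l m)
        where
          m<kˡ⁺¹ : m < k ^ suc l
          m<kˡ⁺¹ = *-cancelˡ-< k m (k ^ suc l)
            (≤-<-trans (≤-trans (m≤n+m (k * m) a) (m≤m+n (a + k * m) k₁)) J<kˡ⁺²)

  regular : Regular k Sq
  regular = regular-by-recurrence k Sq L level-step

-- The entry of a list of naturals at position i, 0 beyond its end.
at : List ℕ → ℕ → ℕ
at []       _       = 0
at (x ∷ xs) zero    = x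
at (x ∷ xs) (suc i) = at xs i

at-++ˡ : ∀ xs ys {i} → i < length xs → at (xs ++ ys) i ≡ at xs i
at-++ˡ (x ∷ xs) ys {zero}  _         = refl
at-++ˡ (x ∷ xs) ys {suc i} (s≤s i<n) = at-++ˡ xs ys i<n

at-++ʳ : ∀ xs ys p → at (xs ++ ys) (length xs + p) ≡ at ys p
at-++ʳ []       ys p = refl
at-++ʳ (x ∷ xs) ys p = at-++ʳ xs ys p

at-concatMap : ∀ n (f : ℕ → List ℕ) → (∀ x → length (f x) ≡ n) →
  ∀ zs {m j} → m < length zs → j < n → at (concatMap f zs) (n * m + j) ≡ at (f (at zs m)) j
at-concatMap n f |f|≡n (z ∷ zs) {zero} {j} _ j<n =
  trans (cong (at (concatMap f (z ∷ zs))) (cong (_+ j) (*-zeroʳ n)))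
        (at-++ˡ (f z) (concatMap f zs) (subst (j <_) (sym (|f|≡n z)) j<n))
at-concatMap n f |f|≡n (z ∷ zs) {suc m} {j} (s≤s m<) j<n = begin
  at (f z ++ concatMap f zs) (n * suc m + j)           ≡⟨ cong (at (f z ++ concatMap f zs)) index ⟩
  at (f z ++ concatMap f zs) (length (f z) + (n * m + j)) ≡⟨ at-++ʳ (f z) (concatMap f zs) (n * m + j) ⟩
  at (concatMap f zs) (n * m + j)                      ≡⟨ at-concatMap n f |f|≡n zs m< j<n ⟩
  at (f (at zs m)) j                                   ∎
  where
    open ≡-Reasoning
    index : n * suc m + j ≡ length (f z) + (n * m + j)
    index = trans (cong (_+ j) (*-suc n m))
                  (trans (+-assoc n (n * m) j) (cong (_+ (n * m + j)) (sym (|f|≡n z))))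

τ-lookup : ∀ xs i → τ (lookupD (map num xs) i) ≡ at xs i
τ-lookup []       i       = refl
τ-lookup (x ∷ xs) zero    = refl
τ-lookup (x ∷ xs) (suc i) = τ-lookup xs i

-- Its τ-image is a block sequence with
-- prefix length a = |0' rest|, block length k = |u| + 1, block word u and increment d,
-- because φ^∞(0') = φ(φ^∞(0')) = 0' rest · φ(τ-letters of φ^∞(0')).
module FixedPoint (u rest : List ℕ) (d : ℕ) where

  f : Letter → Word
  f = φ u rest d

  k₁ k a : ℕ
  k₁ = length u
  k  = suc k₁
  a  = suc (length rest)

  s : ℕ → ℕ
  s i = τ (fixedPoint f i)

  -- φ on letters n ∈ ℤ≥0, and on words over ℤ≥0.
  block : ℕ → List ℕ
  block x = u ++ (x + d) ∷ []

  ψ : List ℕ → List ℕ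
  ψ = concatMap block

  length-block : ∀ x → length (block x) ≡ k
  length-block x = trans (length-++ u) (+-comm k₁ 1)

  length-ψ : ∀ xs → length (ψ xs) ≡ k * length xs
  length-ψ []       = sym (*-zeroʳ k)
  length-ψ (x ∷ xs) = begin
    length (block x ++ ψ xs)          ≡⟨ length-++ (block x) ⟩
    length (block x) + length (ψ xs)  ≡⟨ cong₂ _+_ (length-block x) (length-ψ xs) ⟩
    k + k * length xs                 ≡⟨ sym (*-suc k (length xs)) ⟩
    k * suc (length xs)               ∎
    where open ≡-Reasoning

  φ-numbers : ∀ xs → concatMap f (map num xs) ≡ map num (ψ xs)
  φ-numbers xs = begin
    concatMap f (map num xs)        ≡⟨ concatMap-map f num xs ⟩
    concatMap (f ∘ num) xs          ≡⟨ concatMap-cong (λ x → sym (map-++ num u ((x + d) ∷ []))) xs ⟩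
    concatMap (map num ∘ block) xs  ≡⟨ sym (map-concatMap num block xs) ⟩
    map num (ψ xs)                  ∎
    where open ≡-Reasoning

  -- φⁿ(0') = 0' · (tail n), with τ-image Z n = 0 · tail n.
  tail : ℕ → List ℕ
  tail zero    = []
  tail (suc n) = rest ++ ψ (0 ∷ tail n)

  Z : ℕ → List ℕ
  Z n = 0 ∷ tail n

  iterate : ∀ n → iter n (φ* f) (zero′ ∷ []) ≡ zero′ ∷ map num (tail n)
  iterate zero    = refl
  iterate (suc n) = begin
    φ* f (iter n (φ* f) (zero′ ∷ []))
      ≡⟨ cong (φ* f) (iterate n) ⟩
    ((zero′ ∷ map num rest) ++ f (num 0)) ++ concatMap f (map num (tail n))
      ≡⟨ ++-assoc (zero′ ∷ map num rest) (f (num 0)) _ ⟩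
    (zero′ ∷ map num rest) ++ concatMap f (map num (0 ∷ tail n))
      ≡⟨ cong (λ w → zero′ ∷ map num rest ++ w) (φ-numbers (0 ∷ tail n)) ⟩
    zero′ ∷ map num rest ++ map num (ψ (0 ∷ tail n))
      ≡⟨ cong (zero′ ∷_) (sym (map-++ num rest (ψ (0 ∷ tail n)))) ⟩
    zero′ ∷ map num (tail (suc n))
      ∎
    where open ≡-Reasoning

  s-via-Z : ∀ i → s i ≡ at (Z (suc i)) i
  s-via-Z i = trans (cong (λ w → τ (lookupD w i)) (iterate (suc i))) (τ-head i)
    where
      τ-head : ∀ i → τ (lookupD (zero′ ∷ map num (tail (suc i))) i) ≡ at (Z (suc i)) i
      τ-head zero    = refl
      τ-head (suc i) = τ-lookup (tail (suc (suc i))) i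

  -- Each Z n is a prefix of the later ones, and Z n has more than n entries;
  -- hence every entry of Z n is the corresponding letter of the fixed point.
  Z-extends : ∀ n → ∃[ t ] Z (suc n) ≡ Z n ++ t
  Z-extends zero    = rest ++ ψ (0 ∷ []) , refl
  Z-extends (suc n) with Z-extends n
  ... | t , Zn+1≡ = ψ t , (begin
    (0 ∷ rest) ++ ψ (Z (suc n))         ≡⟨ cong (λ w → (0 ∷ rest) ++ ψ w) Zn+1≡ ⟩
    (0 ∷ rest) ++ ψ (Z n ++ t)          ≡⟨ cong ((0 ∷ rest) ++_) (concatMap-++ block (Z n) t) ⟩
    (0 ∷ rest) ++ (ψ (Z n) ++ ψ t)      ≡⟨ sym (++-assoc (0 ∷ rest) (ψ (Z n)) (ψ t)) ⟩
    ((0 ∷ rest) ++ ψ (Z n)) ++ ψ t      ∎)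
    where open ≡-Reasoning

  Z-prefix : ∀ {m n} → m ℕ.≤′ n → ∃[ t ] Z n ≡ Z m ++ t
  Z-prefix {m} ℕ.≤′-refl = [] , sym (++-identityʳ (Z m))
  Z-prefix {m} (ℕ.≤′-step {n} m≤′n) with Z-prefix m≤′n | Z-extends n
  ... | t , Zn≡ | t′ , Zn+1≡ = t ++ t′ , trans Zn+1≡ (trans (cong (_++ t′) Zn≡) (++-assoc (Z m) t t′))

  length-Z : ∀ n → n < length (Z n)
  length-Z zero    = s≤s z≤n
  length-Z (suc n) = s≤s (begin
    suc n                              ≤⟨ length-Z n ⟩
    length (Z n)                       ≤⟨ m≤n*m (length (Z n)) k ⟩
    k * length (Z n)                   ≡⟨ sym (length-ψ (Z n)) ⟩
    length (ψ (Z n))                   ≤⟨ m≤n+m _ (length rest) ⟩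
    length rest + length (ψ (Z n))     ≡⟨ sym (length-++ rest) ⟩
    length (rest ++ ψ (Z n))           ∎)
    where open ≤-Reasoning

  Z-stable : ∀ n i → i < length (Z n) → at (Z n) i ≡ s i
  Z-stable n i i<|Zn| with ≤-total n (suc i)
  ... | inj₁ n≤i+1 with Z-prefix (≤⇒≤′ n≤i+1)
  ...   | t , Zi+1≡ = sym (trans (s-via-Z i) (trans (cong (λ w → at w i) Zi+1≡) (at-++ˡ (Z n) t i<|Zn|)))
  Z-stable n i i<|Zn| | inj₂ i+1≤n with Z-prefix (≤⇒≤′ i+1≤n)
  ...   | t , Zn≡ = trans (cong (λ w → at w i) Zn≡)
                      (trans (at-++ˡ (Z (suc i)) t (<-trans (n<1+n i) (length-Z (suc i)))) (sym (s-via-Z i)))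

  block-at : ∀ m j → j < k → s (a + k * m + j) ≡ at (block (s m)) j
  block-at m j j<k = begin
    s n                                      ≡⟨ s-via-Z n ⟩
    at (Z (suc n)) n                         ≡⟨ cong (at (Z (suc n))) (+-assoc a (k * m) j) ⟩
    at ((0 ∷ rest) ++ ψ (Z n)) (a + (k * m + j))  ≡⟨ at-++ʳ (0 ∷ rest) (ψ (Z n)) (k * m + j) ⟩
    at (ψ (Z n)) (k * m + j)                 ≡⟨ at-concatMap k block length-block (Z n) m<|Zn| j<k ⟩
    at (block (at (Z n) m)) j                ≡⟨ cong (λ y → at (block y) j) (Z-stable n m m<|Zn|) ⟩
    at (block (s m)) j                       ∎
    where
      open ≡-Reasoning
      n : ℕ
      n = a + k * m + j
      m<|Zn| : m < length (Z n)
      m<|Zn| = ≤-<-trans (≤-trans (m≤n*m m k) (≤-trans (m≤n+m (k * m) a) (m≤m+n (a + k * m) j))) (length-Z n)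

  letter-law : ∀ m j → j < k₁ → s (a + k * m + j) ≡ at u j
  letter-law m j j<k₁ = trans (block-at m j (m<n⇒m<1+n j<k₁)) (at-++ˡ u ((s m + d) ∷ []) j<k₁)

  final-law : ∀ m → s (a + k * m + k₁) ≡ s m + d
  final-law m = trans (block-at m k₁ ≤-refl)
    (trans (cong (at (block (s m))) (sym (+-identityʳ k₁))) (at-++ʳ u ((s m + d) ∷ []) 0))

  regular : .{{_ : NonZero k₁}} → Regular k (λ i → + s i)
  regular = BlockSequence.regular k₁ a d (at u) s letter-law final-law

theorem2p8 : (k d : ℕ) → 2 ≤ k → (u : List ℕ) → length u ≡ k ∸ 1 → (rest : List ℕ) →
    Regular k (λ i → + τ (fixedPoint (φ u rest d) i))
theorem2p8 (suc (suc k₂)) d (s≤s (s≤s z≤n)) u |u|≡k₂+1 rest =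
  subst (λ k₁ → Regular (suc k₁) (λ i → + τ (fixedPoint (φ u rest d) i))) |u|≡k₂+1
    (FixedPoint.regular u rest d {{ℕ.>-nonZero (subst (0 <_) (sym |u|≡k₂+1) (s≤s z≤n))}})
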